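{- Let $G$ be a connected graph with vertex set $X$. If $G$ is Ptolemaic, then there is no edge clique cover $K$ of $G$ with $K\neq K(G)$ and $|K|\le |K(G)|$. In particular, $\mathrm{ecc}(G)=|K(G)|$.
   Context: A graph is Ptolemaic if its shortest-path distance $d^*$ satisfies $d^*(x,y)d^*(z,u)+d^*(x,u)d^*(y,z)\ge d^*(x,z)d^*(y,u)$ for all vertices $x,y,z,u$. A clique is a set $Y$ of vertices with $|Y|\ge2$ that are pairwise adjacent; $K(G)$ is the set of maximal cliques of $G$. An edge clique cover of $G$ is a set $K$ of (not necessarily maximal) cliques of $G$ such that every edge of $G$ is contained in some member of $K$; $\mathrm{ecc}(G)$ is the minimum size of an edge clique cover of $G$. -}

module Defs where

open import Data.Nat using (ℕ; zero; suc; _+_; _*_; _≤_; _<_)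
open import Data.Bool using (Bool; true; false)
open import Data.Fin using (Fin)
open import Data.Fin.Subset using (Subset; _∈_; _⊆_; ∣_∣)
open import Data.List using (List; length)
open import Data.List.Relation.Unary.All using (All)
open import Data.List.Relation.Unary.Unique.Propositional using (Unique)
import Data.List.Membership.Propositional as L
open import Data.Product using (Σ; ∃; _×_; _,_)
open import Function.Bundles using (_⇔_)
open import Relation.Binary.PropositionalEquality using (_≡_; _≢_)
open import Relation.Nullary using (¬_)

record Graph (n : ℕ) : Set where
  field
    adj     : Fin n → Fin n → Bool
    adj-sym : ∀ x y → adj x y ≡ adj y x
    adj-irr : ∀ x → adj x x ≡ false

module _ {n : ℕ} (G : Graph n) where
  open Graph G

  Adj : Fin n → Fin n → Set
  Adj x y = adj x y ≡ true

  data Walk : Fin n → Fin n → ℕ → Set where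
    here : ∀ {x} → Walk x x zero
    step : ∀ {x y z k} → Adj x y → Walk y z k → Walk x z (suc k)

  Connected : Set
  Connected = ∀ x y → ∃ λ k → Walk x y k

  Dist : Fin n → Fin n → ℕ → Set
  Dist x y d = Walk x y d × (∀ k → Walk x y k → d ≤ k)

  Ptolemaic : Set
  Ptolemaic = ∀ x y z u (a b c d e f : ℕ) →
    Dist x y a → Dist z u b → Dist x u c → Dist y z d →
    Dist x z e → Dist y u f →
    e * f ≤ a * b + c * d

  Clique : Subset n → Set
  Clique Y = (2 ≤ ∣ Y ∣) × (∀ x y → x ∈ Y → y ∈ Y → x ≢ y → Adj x y)

  MaximalClique : Subset n → Set
  MaximalClique Y = Clique Y × (∀ Z → Clique Z → Y ⊆ Z → Z ≡ Y)

  -- a finite set of subsets, represented as a duplicate-free list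
  -- Ms lists exactly K(G), the set of maximal cliques
  EnumeratesMaxCliques : List (Subset n) → Set
  EnumeratesMaxCliques Ms = Unique Ms × (∀ Y → (Y L.∈ Ms) ⇔ MaximalClique Y)

  EdgeCliqueCover : List (Subset n) → Set
  EdgeCliqueCover K = Unique K × All Clique K ×
    (∀ x y → Adj x y → Σ (Subset n) λ Y → (Y L.∈ K) × (x ∈ Y) × (y ∈ Y))

  IsEcc : ℕ → Set
  IsEcc m = (Σ (List (Subset n)) λ K → EdgeCliqueCover K × length K ≡ m)
          × (∀ K → EdgeCliqueCover K → m ≤ length K)

  SameSet : List (Subset n) → List (Subset n) → Set
  SameSet K M = ∀ Y → (Y L.∈ K) ⇔ (Y L.∈ M)

{-# OPTIONS --safe #-}
module Submission where

-- By Ptolemy's inequality, the ends of an induced path x ─ a ─ b ─ y are at distance at least 3.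
-- Consequently every vertex v of a maximal clique M has a private partner w ∈ M, i.e. every common
-- neighbour of v and w lies in M, so M is the only maximal clique containing the edge vw: starting
-- from a neighbour x ∉ M of v and a non-neighbour w ∈ M of x, any common neighbour y ∉ M of v and w
-- has strictly fewer non-neighbours in M than x. An edge clique cover K must cover a private edge of
-- each maximal clique M by a clique inside M, and these representatives are pairwise distinct, so
-- |K| ≥ |K(G)|. If |K| ≤ |K(G)|, then K consists of the representatives only, and covering the private
-- edge at each vertex of M shows that the representative of M is M itself.

open import Defs
open import Data.Nat using (ℕ; zero; suc; _≤_; _<_; _∸_; z≤n; s≤s)
open import Data.Nat.Properties using (≤-trans; ≤-pred; n≮n; *-identityʳ; ∸-monoʳ-<)
open import Data.Nat.Induction using (<-wellFounded)
open import Data.Bool using (true)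
import Data.Bool.Properties as Bool
open import Data.Fin using (Fin)
import Data.Fin.Properties as Fin
open import Data.Fin.Subset
  using (Subset; _∈_; _∉_; _⊆_; _⊂_; ∣_∣; _∪_; _∩_; ∁; ⁅_⁆; Nonempty)
open import Data.Fin.Subset.Properties
  using ( _∈?_; nonempty?; Empty-unique; ∣⊥∣≡0; ∣⁅x⁆∣≡1; ⊆-antisym; p⊆q⇒∣p∣≤∣q∣; p⊂q⇒∣p∣<∣q∣
        ; ∣p∣≤n; ∣p∣≤∣p∪q∣; p⊆p∪q; q⊆p∪q; x∈p∪q⁻; x∈⁅x⁆; x∈⁅y⁆⇒x≡y
        ; x∈p∩q⁺; p∩q⊆p; p∩q⊆q; x∉p⇒x∈∁p; x∈∁p⇒x∉p; x∈p∧x≢y⇒x∈p-y; x∈p⇒∣p-x∣<∣p∣ )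
open import Data.Vec using (tabulate)
import Data.Vec.Properties as Vec
open import Data.List using (List; []; _∷_; length; filter)
import Data.List.Properties as List
import Data.List.Membership.Propositional as L
open import Data.List.Membership.Propositional using (mapWith∈)
open import Data.List.Membership.Propositional.Properties using (∈-filter⁺; mapWith∈-cong; mapWith∈-id)
import Data.List.Membership.Setoid.Properties as SetoidMembership
open import Data.List.Relation.Unary.Any using (here; there)
import Data.List.Relation.Unary.Any as Any
open import Data.List.Relation.Unary.Any.Properties using (mapWith∈⁻)
import Data.List.Relation.Unary.All as All
open import Data.List.Relation.Unary.AllPairs using ([]; _∷_)
open import Data.List.Relation.Unary.Unique.Propositional using (Unique)
open import Data.Product using (∃; ∃₂; _×_; _,_; proj₁; proj₂)
open import Data.Sum using (inj₁; inj₂)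
open import Function using (_∘_; id)
open import Function.Bundles using (mk⇔; Equivalence)
open import Induction.WellFounded using (Acc; acc)
open import Relation.Binary.Definitions using (DecidableEquality)
open import Relation.Binary.PropositionalEquality using (_≡_; _≢_; refl; sym; trans; cong; subst; setoid)
open import Axiom.UniquenessOfIdentityProofs using (module Decidable⇒UIP)
open import Relation.Nullary using (¬_; Dec; yes; no; contradiction)
open import Relation.Nullary.Decidable using (_×-dec_; ¬?; _→-dec_; decidable-stable)

module _ {a} {A : Set a} (_≟_ : DecidableEquality A) where
  open import Data.List.Relation.Binary.Subset.Propositional using () renaming (_⊆_ to _⊆ₗ_)
  open import Data.List.Membership.DecPropositional _≟_ using () renaming (_∈?_ to _∈ₗ?_)

  unique-⊆⇒length-≤ : ∀ {xs ys : List A} → Unique xs → xs ⊆ₗ ys → length xs ≤ length ys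
  unique-⊆⇒length-≤ {[]} _ _ = z≤n
  unique-⊆⇒length-≤ {x ∷ xs} {ys} (x∉xs ∷ xs!) x∷xs⊆ys =
    ≤-trans (s≤s (unique-⊆⇒length-≤ xs! xs⊆ys-x)) (List.filter-notAll (¬? ∘ (_≟ x)) ys (x∈ys′))
    where
    xs⊆ys-x : xs ⊆ₗ filter (¬? ∘ (_≟ x)) ys
    xs⊆ys-x z∈xs = ∈-filter⁺ (¬? ∘ (_≟ x)) (x∷xs⊆ys (there z∈xs)) (All.lookup x∉xs z∈xs ∘ sym)
    x∈ys′ : Any.Any (λ y → ¬ ¬ y ≡ x) ys
    x∈ys′ = Any.map (λ { refl ¬x≡x → ¬x≡x refl }) (x∷xs⊆ys (here refl))

  unique-⊆-length-≥⇒⊇ : ∀ {xs ys : List A} → Unique xs → xs ⊆ₗ ys → length ys ≤ length xs → ys ⊆ₗ xs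
  unique-⊆-length-≥⇒⊇ {xs} xs! xs⊆ys ys≤xs {y} y∈ys with y ∈ₗ? xs
  ... | yes y∈xs = y∈xs
  ... | no y∉xs = contradiction (≤-trans (unique-⊆⇒length-≤ (All.tabulate y≢ ∷ xs!) y∷xs⊆ys) ys≤xs) (n≮n _)
    where
    y≢ : ∀ {z} → z L.∈ xs → y ≢ z
    y≢ z∈xs refl = y∉xs z∈xs
    y∷xs⊆ys : (y ∷ xs) ⊆ₗ _
    y∷xs⊆ys (here refl) = y∈ys
    y∷xs⊆ys (there z∈xs) = xs⊆ys z∈xs

mapWith∈-unique : ∀ {a b} {A : Set a} {B : Set b} {xs : List A} (f : ∀ {x} → x L.∈ xs → B) →
  (∀ {x y} (p : x L.∈ xs) (q : y L.∈ xs) → f p ≡ f q → x ≡ y) →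
  Unique xs → Unique (mapWith∈ xs f)
mapWith∈-unique {xs = []} f f-inj [] = []
mapWith∈-unique {xs = x ∷ xs} f f-inj (x∉xs ∷ xs!) =
  All.tabulate head-fresh ∷ mapWith∈-unique (f ∘ there) (λ p q → f-inj (there p) (there q)) xs!
  where
  head-fresh : ∀ {c} → c L.∈ mapWith∈ xs (f ∘ there) → f (here refl) ≢ c
  head-fresh c∈ fx≡c with mapWith∈⁻ xs (f ∘ there) c∈
  ... | y , y∈xs , refl = All.lookup x∉xs y∈xs (f-inj (here refl) (there y∈xs) fx≡c)

_≟ₛ_ : ∀ {n} → DecidableEquality (Subset n)
_≟ₛ_ = Vec.≡-dec Bool._≟_

module _ {n : ℕ} {p : Subset n} where

  distinct-members⇒2≤∣p∣ : ∀ {a b} → a ∈ p → b ∈ p → a ≢ b → 2 ≤ ∣ p ∣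
  distinct-members⇒2≤∣p∣ a∈p b∈p a≢b =
    ≤-trans (s≤s (≤-trans (s≤s z≤n) (x∈p⇒∣p-x∣<∣p∣ (x∈p∧x≢y⇒x∈p-y b∈p (a≢b ∘ sym)))))
            (x∈p⇒∣p-x∣<∣p∣ a∈p)

  1≤∣p∣⇒nonempty : 1 ≤ ∣ p ∣ → Nonempty p
  1≤∣p∣⇒nonempty 1≤∣p∣ with nonempty? p
  ... | yes ne = ne
  ... | no empty = contradiction (subst (1 ≤_) (trans (cong ∣_∣ (Empty-unique empty)) (∣⊥∣≡0 n)) 1≤∣p∣) λ ()

  2≤∣p∣⇒other-member : 2 ≤ ∣ p ∣ → ∀ v → ∃ λ w → w ∈ p × w ≢ v
  2≤∣p∣⇒other-member 2≤∣p∣ v with Fin.any? (λ w → w ∈? p ×-dec ¬? (w Fin.≟ v))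
  ... | yes other = other
  ... | no none = contradiction (≤-trans 2≤∣p∣ (subst (∣ p ∣ ≤_) (∣⁅x⁆∣≡1 v) (p⊆q⇒∣p∣≤∣q∣ p⊆⁅v⁆))) (n≮n 1)
    where
    p⊆⁅v⁆ : p ⊆ ⁅ v ⁆
    p⊆⁅v⁆ {w} w∈p = subst (_∈ ⁅ v ⁆) (sym (decidable-stable (w Fin.≟ v) (λ w≢v → none (w , w∈p , w≢v)))) (x∈⁅x⁆ v)

module _ {n : ℕ} (G : Graph n) where
  open Graph G

  Adj? : ∀ x y → Dec (Adj G x y)
  Adj? x y = adj x y Bool.≟ true

  Adj-sym : ∀ {x y} → Adj G x y → Adj G y x
  Adj-sym {x} {y} xy = trans (adj-sym y x) xy

  Adj⇒≢ : ∀ {x y} → Adj G x y → x ≢ y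
  Adj⇒≢ {x} xx refl with trans (sym xx) (adj-irr x)
  ... | ()

  walk-length-0⇒≡ : ∀ {x y} → Walk G x y 0 → x ≡ y
  walk-length-0⇒≡ here = refl

  walk-length-1⇒Adj : ∀ {x y} → Walk G x y 1 → Adj G x y
  walk-length-1⇒Adj (step xy here) = xy

  Adj⇒dist-1 : ∀ {x y} → Adj G x y → Dist G x y 1
  Adj⇒dist-1 xy = step xy here , λ where
    zero w → contradiction (walk-length-0⇒≡ w) (Adj⇒≢ xy)
    (suc k) _ → s≤s z≤n

  common-neighbour⇒dist-2 : ∀ {x y z} → x ≢ y → ¬ Adj G x y → Adj G x z → Adj G z y → Dist G x y 2
  common-neighbour⇒dist-2 x≢y x≁y xz zy = step xz (step zy here) , λ where
    zero w → contradiction (walk-length-0⇒≡ w) x≢y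
    (suc zero) w → contradiction (walk-length-1⇒Adj w) x≁y
    (suc (suc k)) _ → s≤s (s≤s z≤n)

  common-neighbour⇒dist-≤2 : ∀ {x y z} → x ≢ y → Adj G x z → Adj G z y → ∃ λ c → Dist G x y c × c ≤ 2
  common-neighbour⇒dist-≤2 {x} {y} x≢y xz zy with Adj? x y
  ... | yes xy = 1 , Adj⇒dist-1 xy , s≤s z≤n
  ... | no x≁y = 2 , common-neighbour⇒dist-2 x≢y x≁y xz zy , s≤s (s≤s z≤n)

  -- Ptolemy's inequality for x, a, b, y reads 2 · 2 ≤ 1 · 1 + d(x,y) · 1.
  induced-P4⇒ends-at-dist-≥3 : Ptolemaic G → ∀ {x a b y c} →
    Adj G x a → Adj G a b → Adj G b y → ¬ Adj G x b → ¬ Adj G a y → x ≢ b → a ≢ y →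
    Dist G x y c → 3 ≤ c
  induced-P4⇒ends-at-dist-≥3 ptolemaic {x} {a} {b} {y} {c} xa ab by x≁b a≁y x≢b a≢y dxy =
    ≤-pred (subst (4 ≤_) (cong suc (*-identityʳ c))
      (ptolemaic x a b y 1 1 c 1 2 2 (Adj⇒dist-1 xa) (Adj⇒dist-1 by) dxy (Adj⇒dist-1 ab)
        (common-neighbour⇒dist-2 x≢b x≁b xa ab) (common-neighbour⇒dist-2 a≢y a≁y ab by)))

  Complete : Subset n → Set
  Complete Y = ∀ x y → x ∈ Y → y ∈ Y → x ≢ y → Adj G x y

  ⁅⁆-complete : ∀ x → Complete ⁅ x ⁆
  ⁅⁆-complete x a b a∈⁅x⁆ b∈⁅x⁆ = contradiction (trans (x∈⁅y⁆⇒x≡y x a∈⁅x⁆) (sym (x∈⁅y⁆⇒x≡y x b∈⁅x⁆)))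

  complete-∪-⁅⁆ : ∀ {Y x} → Complete Y → (∀ y → y ∈ Y → Adj G x y) → Complete (Y ∪ ⁅ x ⁆)
  complete-∪-⁅⁆ {Y} {x} Y-complete x-adj a b a∈ b∈ a≢b with x∈p∪q⁻ Y ⁅ x ⁆ a∈ | x∈p∪q⁻ Y ⁅ x ⁆ b∈
  ... | inj₁ a∈Y | inj₁ b∈Y = Y-complete a b a∈Y b∈Y a≢b
  ... | inj₁ a∈Y | inj₂ b∈⁅x⁆ rewrite x∈⁅y⁆⇒x≡y x b∈⁅x⁆ = Adj-sym (x-adj a a∈Y)
  ... | inj₂ a∈⁅x⁆ | inj₁ b∈Y rewrite x∈⁅y⁆⇒x≡y x a∈⁅x⁆ = x-adj b b∈Y
  ... | inj₂ a∈⁅x⁆ | inj₂ b∈⁅x⁆ = ⁅⁆-complete x a b a∈⁅x⁆ b∈⁅x⁆ a≢b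

  clique-∪-⁅⁆ : ∀ {Y x} → Clique G Y → (∀ y → y ∈ Y → Adj G x y) → Clique G (Y ∪ ⁅ x ⁆)
  clique-∪-⁅⁆ {Y} {x} (2≤∣Y∣ , Y-complete) x-adj =
    ≤-trans 2≤∣Y∣ (∣p∣≤∣p∪q∣ Y ⁅ x ⁆) , complete-∪-⁅⁆ Y-complete x-adj

  edge-clique : ∀ {x y} → Adj G x y → Clique G (⁅ x ⁆ ∪ ⁅ y ⁆)
  edge-clique {x} {y} xy =
    distinct-members⇒2≤∣p∣ (p⊆p∪q ⁅ y ⁆ (x∈⁅x⁆ x)) (q⊆p∪q ⁅ x ⁆ ⁅ y ⁆ (x∈⁅x⁆ y)) (Adj⇒≢ xy) ,
    complete-∪-⁅⁆ (⁅⁆-complete x) λ z z∈⁅x⁆ → subst (Adj G y) (sym (x∈⁅y⁆⇒x≡y x z∈⁅x⁆)) (Adj-sym xy)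

  maximal-clique⇒non-neighbour : ∀ {M x} → MaximalClique G M → x ∉ M → ∃ λ w → w ∈ M × ¬ Adj G x w
  maximal-clique⇒non-neighbour {M} {x} (M-clique , M-maximal) x∉M
    with Fin.any? (λ w → w ∈? M ×-dec ¬? (Adj? x w))
  ... | yes non-neighbour = non-neighbour
  ... | no none = contradiction (subst (x ∈_) M∪x≡M (q⊆p∪q M ⁅ x ⁆ (x∈⁅x⁆ x))) x∉M
    where
    M∪x≡M : M ∪ ⁅ x ⁆ ≡ M
    M∪x≡M = M-maximal _ (clique-∪-⁅⁆ M-clique λ y y∈M →
      decidable-stable (Adj? x y) (λ x≁y → none (y , y∈M , x≁y))) (p⊆p∪q ⁅ x ⁆)

  unextendable-clique⇒maximal : ∀ {Y} → Clique G Y → (∀ z → z ∉ Y → ¬ (∀ y → y ∈ Y → Adj G z y)) →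
    MaximalClique G Y
  unextendable-clique⇒maximal {Y} Y-clique unextendable = Y-clique , λ Z Z-clique Y⊆Z → ⊆-antisym (Z⊆Y Z-clique Y⊆Z) Y⊆Z
    where
    Z⊆Y : ∀ {Z} → Clique G Z → Y ⊆ Z → Z ⊆ Y
    Z⊆Y (_ , Z-complete) Y⊆Z {z} z∈Z = decidable-stable (z ∈? Y) λ z∉Y →
      unextendable z z∉Y λ y y∈Y → Z-complete z y z∈Z (Y⊆Z y∈Y) λ { refl → z∉Y y∈Y }

  extend-to-maximal : ∀ {Y} → Clique G Y → ∃ λ Z → MaximalClique G Z × Y ⊆ Z
  extend-to-maximal Y-clique = go Y-clique (<-wellFounded _)
    where
    go : ∀ {Y} → Clique G Y → Acc _<_ (n ∸ ∣ Y ∣) → ∃ λ Z → MaximalClique G Z × Y ⊆ Z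
    go {Y} Y-clique (acc smaller)
      with Fin.any? (λ z → ¬? (z ∈? Y) ×-dec Fin.all? (λ y → y ∈? Y →-dec Adj? z y))
    ... | no unextendable = Y , unextendable-clique⇒maximal Y-clique (λ z z∉Y z-adj → unextendable (z , z∉Y , z-adj)) , id
    ... | yes (z , z∉Y , z-adj) with go (clique-∪-⁅⁆ Y-clique z-adj) (smaller fewer-missing)
      where
      Y⊂Y∪z : Y ⊂ Y ∪ ⁅ z ⁆
      Y⊂Y∪z = p⊆p∪q ⁅ z ⁆ , z , q⊆p∪q Y ⁅ z ⁆ (x∈⁅x⁆ z) , z∉Y
      fewer-missing : n ∸ ∣ Y ∪ ⁅ z ⁆ ∣ < n ∸ ∣ Y ∣
      fewer-missing = ∸-monoʳ-< (p⊂q⇒∣p∣<∣q∣ Y⊂Y∪z) (∣p∣≤n (Y ∪ ⁅ z ⁆))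
    ... | Z , Z-maximal , Y∪z⊆Z = Z , Z-maximal , Y∪z⊆Z ∘ p⊆p∪q ⁅ z ⁆

  edge-in-maximal-clique : ∀ {x y} → Adj G x y → ∃ λ Z → MaximalClique G Z × x ∈ Z × y ∈ Z
  edge-in-maximal-clique {x} {y} xy with extend-to-maximal (edge-clique xy)
  ... | Z , Z-maximal , xy⊆Z = Z , Z-maximal , xy⊆Z (p⊆p∪q ⁅ y ⁆ (x∈⁅x⁆ x)) , xy⊆Z (q⊆p∪q ⁅ x ⁆ ⁅ y ⁆ (x∈⁅x⁆ y))

  neighbourhood : Fin n → Subset n
  neighbourhood x = tabulate (adj x)

  Adj⇒∈-neighbourhood : ∀ {x w} → Adj G x w → w ∈ neighbourhood x
  Adj⇒∈-neighbourhood {x} {w} xw = Vec.lookup⇒[]= w _ (trans (Vec.lookup∘tabulate (adj x) w) xw)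

  ∈-neighbourhood⇒Adj : ∀ {x w} → w ∈ neighbourhood x → Adj G x w
  ∈-neighbourhood⇒Adj {x} {w} w∈N = trans (sym (Vec.lookup∘tabulate (adj x) w)) (Vec.[]=⇒lookup w∈N)

  non-neighbours : Subset n → Fin n → Subset n
  non-neighbours M x = M ∩ ∁ (neighbourhood x)

  non-neighbour⁺ : ∀ {M x w} → w ∈ M → ¬ Adj G x w → w ∈ non-neighbours M x
  non-neighbour⁺ w∈M x≁w = x∈p∩q⁺ (w∈M , x∉p⇒x∈∁p (x≁w ∘ ∈-neighbourhood⇒Adj))

  non-neighbour⁻ : ∀ {M x w} → w ∈ non-neighbours M x → w ∈ M × ¬ Adj G x w
  non-neighbour⁻ {M} {x} w∈ =
    p∩q⊆p M _ w∈ , x∈∁p⇒x∉p (p∩q⊆q M (∁ (neighbourhood x)) w∈) ∘ Adj⇒∈-neighbourhood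

  PrivateEdge : Subset n → Fin n → Fin n → Set
  PrivateEdge M v w = v ∈ M × w ∈ M × v ≢ w × (∀ y → Adj G v y → Adj G w y → y ∈ M)

  private-edge-confines-clique : ∀ {M v w C} → PrivateEdge M v w → Clique G C → v ∈ C → w ∈ C → C ⊆ M
  private-edge-confines-clique {v = v} {w} (v∈M , w∈M , _ , common⊆M) (_ , C-complete) v∈C w∈C {x} x∈C
    with x Fin.≟ v | x Fin.≟ w
  ... | yes refl | _ = v∈M
  ... | no _ | yes refl = w∈M
  ... | no x≢v | no x≢w =
    common⊆M x (C-complete v x v∈C x∈C (x≢v ∘ sym)) (C-complete w x w∈C x∈C (x≢w ∘ sym))

  private-edge-determines-maximal-clique : ∀ {M M' v w} → PrivateEdge M v w → Clique G M →
    MaximalClique G M' → v ∈ M' → w ∈ M' → M' ≡ M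
  private-edge-determines-maximal-clique vw M-clique (M'-clique , M'-maximal) v∈M' w∈M' =
    sym (M'-maximal _ M-clique (private-edge-confines-clique vw M'-clique v∈M' w∈M'))

  module _ (ptolemaic : Ptolemaic G) {M v} (M-maximal : MaximalClique G M) (v∈M : v ∈ M) where

    -- x ─ a ─ w ─ y would be an induced P4 whose ends have the common neighbour v.
    common-neighbour-outside-shrinks : ∀ {x y w} → x ∉ M → y ∉ M → Adj G v x → Adj G v y →
      w ∈ M → ¬ Adj G x w → Adj G w y → non-neighbours M y ⊂ non-neighbours M x
    common-neighbour-outside-shrinks {x} {y} {w} x∉M y∉M vx vy w∈M x≁w wy =
      ⊆ , w , non-neighbour⁺ w∈M x≁w , (λ w∈ → proj₂ (non-neighbour⁻ w∈) (Adj-sym wy))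
      where
      ⊆ : non-neighbours M y ⊆ non-neighbours M x
      ⊆ {a} a∈ with non-neighbour⁻ a∈
      ... | a∈M , y≁a = non-neighbour⁺ a∈M λ xa →
        let a≢w = λ { refl → x≁w xa }
            x≢y = λ { refl → y≁a xa }
            (c , dxy , c≤2) = common-neighbour⇒dist-≤2 x≢y (Adj-sym vx) vy
        in n≮n 2 (≤-trans
             (induced-P4⇒ends-at-dist-≥3 ptolemaic xa (proj₂ (proj₁ M-maximal) a w a∈M w∈M a≢w)
               wy x≁w (y≁a ∘ Adj-sym) (λ { refl → x∉M w∈M }) (λ { refl → y∉M a∈M }) dxy)
             c≤2)

    private-partner : ∃ (PrivateEdge M v)
    private-partner with Fin.any? (λ x → ¬? (x ∈? M) ×-dec Adj? v x)
    ... | yes (x , x∉M , vx) = descend x∉M vx (<-wellFounded _)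
      where
      descend : ∀ {x} → x ∉ M → Adj G v x → Acc _<_ ∣ non-neighbours M x ∣ → ∃ (PrivateEdge M v)
      descend {x} x∉M vx (acc smaller) with maximal-clique⇒non-neighbour M-maximal x∉M
      ... | w , w∈M , x≁w with Fin.any? (λ y → Adj? w y ×-dec Adj? v y ×-dec ¬? (y ∈? M))
      ...   | yes (y , wy , vy , y∉M) = descend y∉M vy
                (smaller (p⊂q⇒∣p∣<∣q∣ (common-neighbour-outside-shrinks x∉M y∉M vx vy w∈M x≁w wy)))
      ...   | no none = w , v∈M , w∈M , (λ { refl → x≁w (Adj-sym vx) }) , λ y vy wy →
                decidable-stable (y ∈? M) (λ y∉M → none (y , wy , vy , y∉M))
    ... | no none with 2≤∣p∣⇒other-member (proj₁ (proj₁ M-maximal)) v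
    ...   | w , w∈M , w≢v = w , v∈M , w∈M , w≢v ∘ sym , λ y vy _ →
              decidable-stable (y ∈? M) (λ y∉M → none (y , y∉M , vy))

  Represents : Subset n → Subset n → Set
  Represents M C = C ⊆ M × ∃₂ λ v w → PrivateEdge M v w × v ∈ C × w ∈ C

  represents-injective : ∀ {M M' C} → Clique G M → MaximalClique G M' →
    Represents M C → Represents M' C → M' ≡ M
  represents-injective M-clique M'-maximal (_ , v , w , vw , v∈C , w∈C) (C⊆M' , _) =
    private-edge-determines-maximal-clique vw M-clique M'-maximal (C⊆M' v∈C) (C⊆M' w∈C)

  covering-representative : ∀ {K M v w} → EdgeCliqueCover G K → Clique G M → PrivateEdge M v w →
    ∃ λ C → C L.∈ K × Represents M C × v ∈ C
  covering-representative {v = v} {w} (_ , K-cliques , covers) (_ , M-complete) vw@(v∈M , w∈M , v≢w , _)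
    with covers v w (M-complete v w v∈M w∈M v≢w)
  ... | C , C∈K , v∈C , w∈C =
    C , C∈K , (private-edge-confines-clique vw (All.lookup K-cliques C∈K) v∈C w∈C , v , w , vw , v∈C , w∈C) , v∈C

  maximal-cliques-cover : ∀ {Ms} → EnumeratesMaxCliques G Ms → EdgeCliqueCover G Ms
  maximal-cliques-cover {Ms} (Ms! , Ms-maximal) =
    Ms! , All.tabulate (proj₁ ∘ Equivalence.to (Ms-maximal _)) , covers
    where
    covers : ∀ x y → Adj G x y → ∃ λ Y → Y L.∈ Ms × x ∈ Y × y ∈ Y
    covers x y xy with edge-in-maximal-clique xy
    ... | Z , Z-maximal , x∈Z , y∈Z = Z , Equivalence.from (Ms-maximal Z) Z-maximal , x∈Z , y∈Z

  module _ (ptolemaic : Ptolemaic G) {Ms : List (Subset n)} (Ms-enumerates : EnumeratesMaxCliques G Ms)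
           {K : List (Subset n)} (K-covers : EdgeCliqueCover G K) where

    maximal : ∀ {M} → M L.∈ Ms → MaximalClique G M
    maximal = Equivalence.to (proj₂ Ms-enumerates _)

    representative-of : ∀ {M} → M L.∈ Ms → ∃ λ C → C L.∈ K × Represents M C
    representative-of M∈Ms with maximal M∈Ms
    ... | M-maximal@((2≤∣M∣ , _) , _) with 1≤∣p∣⇒nonempty (≤-trans (s≤s z≤n) 2≤∣M∣)
    ...   | v , v∈M with covering-representative K-covers (proj₁ M-maximal)
                           (proj₂ (private-partner ptolemaic M-maximal v∈M))
    ...     | C , C∈K , C-represents , _ = C , C∈K , C-represents

    representative : ∀ {M} → M L.∈ Ms → Subset n
    representative = proj₁ ∘ representative-of

    representatives : List (Subset n)
    representatives = mapWith∈ Ms representative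

    representatives-unique : Unique representatives
    representatives-unique = mapWith∈-unique representative
      (λ p q eq → represents-injective (proj₁ (maximal q)) (maximal p)
                    (subst (Represents _) (sym eq) (proj₂ (proj₂ (representative-of q))))
                    (proj₂ (proj₂ (representative-of p))))
      (proj₁ Ms-enumerates)

    representatives⊆K : ∀ {C} → C L.∈ representatives → C L.∈ K
    representatives⊆K C∈ with mapWith∈⁻ Ms representative C∈
    ... | M , M∈Ms , refl = proj₁ (proj₂ (representative-of M∈Ms))

    length-representatives : length representatives ≡ length Ms
    length-representatives = SetoidMembership.length-mapWith∈ (setoid (Subset n)) Ms

    ecc-lower-bound : length Ms ≤ length K
    ecc-lower-bound = subst (_≤ length K) length-representatives
      (unique-⊆⇒length-≤ _≟ₛ_ representatives-unique representatives⊆K)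

    module _ (K≤Ms : length K ≤ length Ms) where

      K⊆representatives : ∀ {C} → C L.∈ K → C L.∈ representatives
      K⊆representatives = unique-⊆-length-≥⇒⊇ _≟ₛ_ representatives-unique representatives⊆K
        (subst (length K ≤_) (sym length-representatives) K≤Ms)

      representative-is-maximal-clique : ∀ {M} (M∈Ms : M L.∈ Ms) → representative M∈Ms ≡ M
      representative-is-maximal-clique {M} M∈Ms =
        ⊆-antisym (proj₁ (proj₂ (proj₂ (representative-of M∈Ms)))) M⊆representative
        where
        M-clique : Clique G M
        M-clique = proj₁ (maximal M∈Ms)
        M∈Ms-irrelevant : ∀ (p : M L.∈ Ms) → p ≡ M∈Ms
        M∈Ms-irrelevant p = SetoidMembership.unique⇒irrelevant (setoid (Subset n))
          (Decidable⇒UIP.≡-irrelevant _≟ₛ_) (proj₁ Ms-enumerates) p M∈Ms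
        M⊆representative : M ⊆ representative M∈Ms
        M⊆representative {z} z∈M
          with covering-representative K-covers M-clique (proj₂ (private-partner ptolemaic (maximal M∈Ms) z∈M))
        ... | C , C∈K , C-represents , z∈C with mapWith∈⁻ Ms representative (K⊆representatives C∈K)
        ...   | M' , M'∈Ms , refl with represents-injective M-clique (maximal M'∈Ms) C-represents
                                     (proj₂ (proj₂ (representative-of M'∈Ms)))
        ...     | refl = subst (λ p → z ∈ representative p) (M∈Ms-irrelevant M'∈Ms) z∈C

      representatives≡Ms : representatives ≡ Ms
      representatives≡Ms = trans (mapWith∈-cong Ms representative (λ {M} _ → M) representative-is-maximal-clique)
                                 (mapWith∈-id Ms)

      tight-cover-is-maximal-cliques : SameSet G K Ms
      tight-cover-is-maximal-cliques Y =
        mk⇔ (subst (Y L.∈_) representatives≡Ms ∘ K⊆representatives)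
            (representatives⊆K ∘ subst (Y L.∈_) (sym representatives≡Ms))

theorem5p2 : {n : ℕ} (G : Graph n) → Connected G → Ptolemaic G →
    (Ms : List (Subset n)) → EnumeratesMaxCliques G Ms →
    ((K : List (Subset n)) → EdgeCliqueCover G K → ¬ SameSet G K Ms →
      ¬ (length K ≤ length Ms))
    × IsEcc G (length Ms)
theorem5p2 G _ ptolemaic Ms Ms-enumerates =
  (λ K K-covers K≠Ms K≤Ms → K≠Ms (tight-cover-is-maximal-cliques G ptolemaic Ms-enumerates K-covers K≤Ms)) ,
  (Ms , maximal-cliques-cover G Ms-enumerates , refl) ,
  (λ K K-covers → ecc-lower-bound G ptolemaic Ms-enumerates K-covers)
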